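{- Let $\ell\ge 2$, let $k_1,\dots,k_\ell$ be positive integers with $k=\sum_{i=1}^\ell k_i$, and let $p_1,\dots,p_\ell$ be positive real numbers. Let $H_\ell(z)=\sum_{\omega}\Big(\prod_{i=1}^\ell p_i^{|\omega|_i}\Big)z^{|\omega|}$, where the sum runs over all finite words $\omega$ over $\{1,\dots,\ell\}$ that end with the pattern $(k_1,\dots,k_\ell)$. Then \[ H_\ell(z)=\frac{\prod_{i=1}^\ell p_i^{k_i}\,z^k}{\big(1-z\sum_{i=1}^\ell p_i\big)\prod_{i=2}^{\ell}(1-p_iz)}. \]
   Context: For a word $\omega$, $|\omega|$ is its length and $|\omega|_i$ the number of occurrences of letter $i$. A word over $\{1,\dots,\ell\}$ ends with the pattern $(k_1,\dots,k_\ell)$ if it has the form $u\,1^{a_1}2^{a_2}\cdots\ell^{a_\ell}$ with $a_i\ge k_i$ for all $i$, and $u$ either empty or a word whose last letter is not $1$. When $\sum p_i=1$, the coefficient of $z^n$ in $H_\ell(z)$ is the probability that a sequence of $n$ independent trials with $P(i)=p_i$ ends with this pattern. -}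

module Defs where

open import Level using (Level)
open import Algebra.Bundles using (CommutativeRing)
open import Data.Nat using (ℕ; zero; suc; _∸_; _≤_)
open import Data.Fin using (Fin; toℕ) renaming (zero to fzero; suc to fsuc)
open import Data.Fin.Properties using (_≟_)
open import Data.List using (List; []; _∷_; _++_; [_]; replicate; concatMap; filter; length; allFin; foldr; map)
open import Data.Product using (Σ; ∃; _×_)
open import Data.Sum using (_⊎_)
open import Relation.Binary.PropositionalEquality using (_≡_; _≢_)

-- Words over the alphabet {1,…,ℓ} are lists over Fin ℓ; letter 1 is fzero,
-- letter i is the element of Fin ℓ with toℕ = i - 1.

count : {ℓ : ℕ} → Fin ℓ → List (Fin ℓ) → ℕ
count i ω = length (filter (_≟ i) ω)

blocks : {ℓ : ℕ} → (Fin ℓ → ℕ) → List (Fin ℓ)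
blocks {ℓ} a = concatMap (λ i → replicate (a i) i) (allFin ℓ)

EndsWith : {ℓ : ℕ} → (Fin ℓ → ℕ) → List (Fin ℓ) → Set
EndsWith {ℓ} k ω =
  Σ (List (Fin ℓ)) λ u → Σ (Fin ℓ → ℕ) λ a →
    ((i : Fin ℓ) → k i ≤ a i) × (ω ≡ u ++ blocks a) ×
    (u ≡ [] ⊎ Σ (List (Fin ℓ)) λ v → Σ (Fin ℓ) λ x → (u ≡ v ++ [ x ]) × (toℕ x ≢ 0))

sumℕFin : (n : ℕ) → (Fin n → ℕ) → ℕ
sumℕFin zero f = 0
sumℕFin (suc n) f = f fzero Data.Nat.+ sumℕFin n (λ j → f (fsuc j))

module Series {c r : Level} (R : CommutativeRing c r) where
  open CommutativeRing R

  Ser : Set c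
  Ser = ℕ → Carrier

  pow : Carrier → ℕ → Carrier
  pow x zero = 1#
  pow x (suc n) = x * pow x n

  ∑Fin : (n : ℕ) → (Fin n → Carrier) → Carrier
  ∑Fin zero f = 0#
  ∑Fin (suc n) f = f fzero + ∑Fin n (λ j → f (fsuc j))

  ∏Fin : (n : ℕ) → (Fin n → Carrier) → Carrier
  ∏Fin zero f = 1#
  ∏Fin (suc n) f = f fzero * ∏Fin n (λ j → f (fsuc j))

  ∑List : List Carrier → Carrier
  ∑List = foldr _+_ 0#

  ∑< : ℕ → (ℕ → Carrier) → Carrier
  ∑< zero f = 0#
  ∑< (suc n) f = ∑< n f + f n

  _⊛_ : Ser → Ser → Ser
  (f ⊛ g) n = ∑< (suc n) (λ j → f j * g (n ∸ j))

  oneS : Ser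
  oneS zero = 1#
  oneS (suc n) = 0#

  monomial : Carrier → ℕ → Ser
  monomial c zero zero = c
  monomial c zero (suc n) = 0#
  monomial c (suc m) zero = 0#
  monomial c (suc m) (suc n) = monomial c m n

  -- 1/(1 - a z) = Σ a^n z^n
  geom : Carrier → Ser
  geom a n = pow a n

  ∏Ser : (n : ℕ) → (Fin n → Ser) → Ser
  ∏Ser zero f = oneS
  ∏Ser (suc n) f = f fzero ⊛ ∏Ser n (λ j → f (fsuc j))

  ∏Ser-from2 : (ℓ : ℕ) → (Fin ℓ → Ser) → Ser
  ∏Ser-from2 zero f = oneS
  ∏Ser-from2 (suc m) f = ∏Ser m (λ j → f (fsuc j))

  weight : {ℓ : ℕ} → (Fin ℓ → Carrier) → List (Fin ℓ) → Carrier
  weight {ℓ} p ω = ∏Fin ℓ (λ i → pow (p i) (count i ω))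

  rhs : (ℓ : ℕ) → (Fin ℓ → ℕ) → (Fin ℓ → Carrier) → Ser
  rhs ℓ k p =
    (monomial (∏Fin ℓ (λ i → pow (p i) (k i))) (sumℕFin ℓ k)
      ⊛ geom (∑Fin ℓ p))
      ⊛ ∏Ser-from2 ℓ (λ i → geom (p i))

-- A word ending with the pattern is uniquely w 1^k₁ 2^(k₂+b₁) ⋯ ℓ^(k_ℓ+b_{ℓ-1}) with w an arbitrary
-- word and b ∈ ℕ^(ℓ-1): any excess of letter 1 is absorbed into w, which also disposes of the
-- condition on the letter before the final blocks, and w is recovered as the part before the last
-- occurrence of 1 because k₁ ≥ 1. The weight of such a word is ∏ p_i^k_i times the weight of w times
-- ∏_{i≥2} p_i^b_{i-1}, so the weighted count of the words of length k + s is the Cauchy product, at s,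
-- of (∑ p_i)^t (the words w of length t: coefficients of 1/(1 - z ∑ p_i)) with the sum over the b of
-- total s (coefficients of ∏_{i≥2} 1/(1 - p_i z)).
module Submission where

open import Defs
open import Level using (Level)
open import Algebra.Bundles using (CommutativeRing)
import Algebra.Properties.CommutativeSemigroup as CommutativeSemigroupProperties
open import Data.Empty using (⊥; ⊥-elim)
open import Data.Nat using (ℕ; zero; suc; _∸_; _≤_; _<_; s≤s; _<?_)
import Data.Nat as ℕ
import Data.Nat.Properties as ℕ
open import Data.Fin using (Fin; toℕ) renaming (zero to fzero; suc to fsuc)
import Data.Fin.Properties as Fin
open import Data.List
  using (List; []; _∷_; _++_; [_]; length; map; replicate; concatMap; allFin; upTo; cartesianProductWith)
import Data.List.Properties as List
open import Data.List.Membership.Propositional using (_∈_; find; lose)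
open import Data.List.Membership.Propositional.Properties
  using (∈-concatMap⁺; ∈-concatMap⁻; ∈-cartesianProductWith⁺; ∈-cartesianProductWith⁻; ∈-upTo⁺; ∈-upTo⁻; ∈-allFin; ∈-map⁺; ∈-map⁻)
open import Data.List.Membership.Propositional.Properties.WithK using (unique∧set⇒bag)
open import Data.List.Relation.Binary.BagAndSetEquality using (∼bag⇒↭)
open import Data.List.Relation.Binary.Permutation.Propositional using (_↭_; ↭⇒↭ₛ′)
import Data.List.Relation.Binary.Permutation.Propositional.Properties as Perm
open import Data.List.Relation.Binary.Permutation.Setoid.Properties using (foldr-commMonoid)
open import Data.List.Relation.Unary.Any using (here)
import Data.List.Relation.Unary.All as All
import Data.List.Relation.Unary.All.Properties as All
import Data.List.Relation.Unary.AllPairs as AllPairs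
import Data.List.Relation.Unary.AllPairs.Properties as AllPairs
open import Data.List.Relation.Unary.Unique.Propositional using (Unique)
import Data.List.Relation.Unary.Unique.Propositional.Properties as Unique
open import Data.Vec using (Vec; []; _∷_; lookup; tabulate)
import Data.Vec.Properties as Vec
open import Data.Product using (Σ; ∃; _×_; _,_; proj₁; proj₂)
open import Data.Sum using (_⊎_; inj₁; inj₂)
open import Function using (_∘_; case_of_)
open import Function.Bundles using (_⇔_; mk⇔; Equivalence)
open import Function.Construct.Composition using (_⇔-∘_)
open import Function.Construct.Symmetry using (⇔-sym)
open import Relation.Nullary using (yes; no; contradiction)
open import Relation.Binary.PropositionalEquality
  using (_≡_; _≢_; _≗_; refl; sym; trans; cong; cong₂; subst; module ≡-Reasoning)

private
  variable
    A B C : Set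

∈-concatMap⁺′ : (g : A → List B) {xs : List A} {x : A} {y : B} → x ∈ xs → y ∈ g x → y ∈ concatMap g xs
∈-concatMap⁺′ g x∈xs y∈gx = ∈-concatMap⁺ g (lose x∈xs y∈gx)

∈-concatMap⁻′ : (g : A → List B) {xs : List A} {y : B} → y ∈ concatMap g xs → ∃ λ x → x ∈ xs × y ∈ g x
∈-concatMap⁻′ g = find ∘ ∈-concatMap⁻ g

concatMap-unique : (g : A → List B) {xs : List A} → Unique xs → (∀ x → Unique (g x)) →
                   (∀ {x x′ y} → y ∈ g x → y ∈ g x′ → x ≡ x′) → Unique (concatMap g xs)
concatMap-unique g xs! g! fibres = Unique.concat⁺
  (All.map⁺ (All.universal g! _))
  (AllPairs.map⁺ {f = g} (AllPairs.map (λ x≢x′ {_} (y∈gx , y∈gx′) → x≢x′ (fibres y∈gx y∈gx′)) xs!))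

singleton-unique : (x : A) → Unique [ x ]
singleton-unique x = All.[] AllPairs.∷ AllPairs.[]

record Enumerates {A : Set} (size : A → ℕ) (E : ℕ → List A) : Set where
  field
    unique   : ∀ s → Unique (E s)
    sound    : ∀ {s x} → x ∈ E s → size x ≡ s
    complete : ∀ {s x} → size x ≡ s → x ∈ E s

open Enumerates

singletons-enumerate : Enumerates (λ n → n) [_]
singletons-enumerate = record
  { unique   = singleton-unique
  ; sound    = λ { (here x≡s) → x≡s }
  ; complete = λ x≡s → here x≡s
  }

cauchyProductWith : (A → B → C) → (ℕ → List A) → (ℕ → List B) → ℕ → List C
cauchyProductWith f E F s = concatMap (λ t → cartesianProductWith f (E t) (F (s ∸ t))) (upTo (suc s))

module _ {σ : A → ℕ} {τ : B → ℕ} {E : ℕ → List A} {F : ℕ → List B}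
         (f : A → B → C) (f-injective : ∀ {x x′ y y′} → f x y ≡ f x′ y′ → x ≡ x′ × y ≡ y′)
         (E-enum : Enumerates σ E) (F-enum : Enumerates τ F) where

  private
    slice : ℕ → ℕ → List C
    slice s t = cartesianProductWith f (E t) (F (s ∸ t))

    slice⁻ : ∀ {s t x y} → f x y ∈ slice s t → σ x ≡ t × τ y ≡ s ∸ t
    slice⁻ {s} {t} fxy∈
      with _ , _ , x′∈ , y′∈ , fxy≡ ← ∈-cartesianProductWith⁻ f (E t) (F (s ∸ t)) fxy∈
      with refl , refl ← f-injective fxy≡
      = sound E-enum x′∈ , sound F-enum y′∈

  cauchyProductWith-sound : ∀ {s x y} → f x y ∈ cauchyProductWith f E F s → σ x ℕ.+ τ y ≡ s
  cauchyProductWith-sound {s} fxy∈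
    with t , t∈ , fxy∈slice ← ∈-concatMap⁻′ (slice s) fxy∈
    with σx≡t , τy≡s∸t ← slice⁻ fxy∈slice
    = trans (cong₂ ℕ._+_ σx≡t τy≡s∸t) (ℕ.m+[n∸m]≡n (ℕ.≤-pred (∈-upTo⁻ t∈)))

  cauchyProductWith-complete : ∀ {s x y} → σ x ℕ.+ τ y ≡ s → f x y ∈ cauchyProductWith f E F s
  cauchyProductWith-complete {s} {x} {y} refl =
    ∈-concatMap⁺′ (slice s) (∈-upTo⁺ (s≤s (ℕ.m≤m+n (σ x) (τ y))))
      (∈-cartesianProductWith⁺ f (complete E-enum refl) (complete F-enum (sym (ℕ.m+n∸m≡n (σ x) (τ y)))))

  cauchyProductWith-unique : ∀ s → Unique (cauchyProductWith f E F s)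
  cauchyProductWith-unique s = concatMap-unique (slice s) (Unique.upTo⁺ (suc s))
      (λ t → Unique.cartesianProductWith⁺ f f-injective (unique E-enum t) (unique F-enum (s ∸ t)))
      sameSlice
    where
      sameSlice : ∀ {t t′ z} → z ∈ slice s t → z ∈ slice s t′ → t ≡ t′
      sameSlice {t} {t′} z∈ z∈′ with _ , _ , _ , _ , refl ← ∈-cartesianProductWith⁻ f (E t) (F (s ∸ t)) z∈ =
        trans (sym (proj₁ (slice⁻ z∈))) (proj₁ (slice⁻ z∈′))

words : {L : ℕ} → ℕ → List (List (Fin L))
words zero    = [ [] ]
words (suc t) = cartesianProductWith _∷_ (allFin _) (words t)

words-enumerate : {L : ℕ} → Enumerates length (words {L})
words-enumerate {L} = record { unique = unique′ ; sound = sound′ ; complete = complete′ }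
  where
    unique′ : ∀ t → Unique (words {L} t)
    unique′ zero    = singleton-unique []
    unique′ (suc t) = Unique.cartesianProductWith⁺ _∷_ List.∷-injective (Unique.allFin⁺ L) (unique′ t)

    sound′ : ∀ {t} {ω : List (Fin L)} → ω ∈ words t → length ω ≡ t
    sound′ {zero}  (here refl) = refl
    sound′ {suc t} ω∈ with _ , _ , _ , ω′∈ , refl ← ∈-cartesianProductWith⁻ _∷_ (allFin L) (words t) ω∈ =
      cong suc (sound′ ω′∈)

    complete′ : ∀ {t} {ω : List (Fin L)} → length ω ≡ t → ω ∈ words t
    complete′ {zero}  {[]}    refl = here refl
    complete′ {suc t} {x ∷ ω} refl = ∈-cartesianProductWith⁺ _∷_ (∈-allFin x) (complete′ refl)

compositions : (r : ℕ) → ℕ → List (Vec ℕ r)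
compositions zero    zero    = [ [] ]
compositions zero    (suc s) = []
compositions (suc r)         = cauchyProductWith _∷_ [_] (compositions r)

∣_∣ : {r : ℕ} → Vec ℕ r → ℕ
∣_∣ {r} b = sumℕFin r (lookup b)

compositions-enumerate : ∀ r → Enumerates ∣_∣ (compositions r)
compositions-enumerate zero = record { unique = unique′ ; sound = sound′ ; complete = complete′ }
  where
    unique′ : ∀ s → Unique (compositions zero s)
    unique′ zero    = singleton-unique []
    unique′ (suc s) = AllPairs.[]

    sound′ : ∀ {s b} → b ∈ compositions zero s → ∣ b ∣ ≡ s
    sound′ {zero} {[]} _ = refl

    complete′ : ∀ {s b} → ∣ b ∣ ≡ s → b ∈ compositions zero s
    complete′ {zero} {[]} refl = here refl
compositions-enumerate (suc r) = record
  { unique   = cauchyProductWith-unique _∷_ Vec.∷-injective singletons-enumerate (compositions-enumerate r)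
  ; sound    = λ { {x = _ ∷ _} → cauchyProductWith-sound _∷_ Vec.∷-injective singletons-enumerate (compositions-enumerate r) }
  ; complete = λ { {x = _ ∷ _} → cauchyProductWith-complete _∷_ Vec.∷-injective singletons-enumerate (compositions-enumerate r) }
  }

replicate-+ : ∀ m n (x : A) → replicate (m ℕ.+ n) x ≡ replicate m x ++ replicate n x
replicate-+ zero    n x = refl
replicate-+ (suc m) n x = cong (x ∷_) (replicate-+ m n x)

sumℕFin-+ : ∀ n (f g : Fin n → ℕ) → sumℕFin n (λ i → f i ℕ.+ g i) ≡ sumℕFin n f ℕ.+ sumℕFin n g
sumℕFin-+ zero    f g = refl
sumℕFin-+ (suc n) f g = trans (cong (f fzero ℕ.+ g fzero ℕ.+_) (sumℕFin-+ n (f ∘ fsuc) (g ∘ fsuc)))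
  (CommutativeSemigroupProperties.interchange ℕ.+-commutativeSemigroup (f fzero) (g fzero) _ _)

blocks-suc : {n : ℕ} (a : Fin (suc n) → ℕ) → blocks a ≡ replicate (a fzero) fzero ++ map fsuc (blocks (a ∘ fsuc))
blocks-suc {n} a = cong (replicate (a fzero) fzero ++_) (begin
  concatMap block (Data.List.tabulate fsuc)           ≡⟨ cong (concatMap block) (sym (List.map-tabulate (λ i → i) fsuc)) ⟩
  concatMap block (map fsuc (allFin n))               ≡⟨ List.concatMap-map block fsuc (allFin n) ⟩
  concatMap (block ∘ fsuc) (allFin n)                 ≡⟨ List.concatMap-cong (λ i → sym (List.map-replicate fsuc (a (fsuc i)) i)) (allFin n) ⟩
  concatMap (map fsuc ∘ block′) (allFin n)            ≡⟨ sym (List.map-concatMap fsuc block′ (allFin n)) ⟩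
  map fsuc (concatMap block′ (allFin n))              ∎)
  where
    open ≡-Reasoning
    block : Fin (suc n) → List (Fin (suc n))
    block i = replicate (a i) i
    block′ : Fin n → List (Fin n)
    block′ i = replicate (a (fsuc i)) i

blocks-cong : {n : ℕ} {a a′ : Fin n → ℕ} → a ≗ a′ → blocks a ≡ blocks a′
blocks-cong a≗a′ = List.concatMap-cong (λ i → cong (λ e → replicate e i) (a≗a′ i)) (allFin _)

length-blocks : {n : ℕ} (a : Fin n → ℕ) → length (blocks a) ≡ sumℕFin n a
length-blocks {zero}  a = refl
length-blocks {suc n} a = begin
  length (blocks a)                                                  ≡⟨ cong length (blocks-suc a) ⟩
  length (replicate (a fzero) fzero ++ map fsuc (blocks (a ∘ fsuc))) ≡⟨ List.length-++ (replicate (a fzero) fzero) ⟩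
  length (replicate (a fzero) fzero) ℕ.+ length (map fsuc (blocks (a ∘ fsuc)))
    ≡⟨ cong₂ ℕ._+_ (List.length-replicate (a fzero)) (trans (List.length-map fsuc (blocks (a ∘ fsuc))) (length-blocks (a ∘ fsuc))) ⟩
  sumℕFin (suc n) a                                                  ∎
  where open ≡-Reasoning

replicate++map-injective : {n : ℕ} (c c′ : ℕ) {X X′ : List (Fin n)} →
  replicate c fzero ++ map fsuc X ≡ replicate c′ fzero ++ map fsuc X′ → c ≡ c′ × X ≡ X′
replicate++map-injective zero    zero    eq = refl , List.map-injective Fin.suc-injective eq
replicate++map-injective zero    (suc c′) {x ∷ X} ()
replicate++map-injective (suc c) zero    {X′ = x ∷ X′} ()
replicate++map-injective (suc c) (suc c′) eq
  with refl , X≡X′ ← replicate++map-injective c c′ (List.∷-injectiveʳ eq) = refl , X≡X′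

blocks-injective : {n : ℕ} (a a′ : Fin n → ℕ) → blocks a ≡ blocks a′ → a ≗ a′
blocks-injective {suc n} a a′ eq
  with a₀≡ , rest≡ ← replicate++map-injective (a fzero) (a′ fzero) (trans (sym (blocks-suc a)) (trans eq (blocks-suc a′)))
  = λ { fzero → a₀≡ ; (fsuc i) → blocks-injective (a ∘ fsuc) (a′ ∘ fsuc) rest≡ i }

map-suc≢++zero∷ : {n : ℕ} (X : List (Fin n)) (v Y : List (Fin (suc n))) → map fsuc X ≢ v ++ fzero ∷ Y
map-suc≢++zero∷ []      []      Y ()
map-suc≢++zero∷ (x ∷ X) []      Y ()
map-suc≢++zero∷ []      (y ∷ v) Y ()
map-suc≢++zero∷ (x ∷ X) (y ∷ v) Y eq = map-suc≢++zero∷ X v Y (List.∷-injectiveʳ eq)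

lastZero-injective : {n : ℕ} (v v′ : List (Fin (suc n))) {X X′ : List (Fin n)} →
  v ++ fzero ∷ map fsuc X ≡ v′ ++ fzero ∷ map fsuc X′ → v ≡ v′ × X ≡ X′
lastZero-injective []      []       eq = refl , List.map-injective Fin.suc-injective (List.∷-injectiveʳ eq)
lastZero-injective []      (y ∷ v′) eq = contradiction (List.∷-injectiveʳ eq) (map-suc≢++zero∷ _ v′ _)
lastZero-injective (y ∷ v) []       eq = contradiction (sym (List.∷-injectiveʳ eq)) (map-suc≢++zero∷ _ v _)
lastZero-injective (y ∷ v) (y′ ∷ v′) eq
  with refl , eq′ ← List.∷-injective eq
  with refl , X≡X′ ← lastZero-injective v v′ eq′
  = refl , X≡X′

LastLetterNotOne : {n : ℕ} → List (Fin n) → Set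
LastLetterNotOne {n} u = u ≡ [] ⊎ Σ (List (Fin n)) λ v → Σ (Fin n) λ x → (u ≡ v ++ [ x ]) × (toℕ x ≢ 0)

splitTrailingOnes : {n : ℕ} (w : List (Fin (suc n))) →
  Σ (List (Fin (suc n))) λ u → Σ ℕ λ j → (w ≡ u ++ replicate j fzero) × LastLetterNotOne u
splitTrailingOnes [] = [] , 0 , refl , inj₁ refl
splitTrailingOnes (x ∷ w) with splitTrailingOnes w
splitTrailingOnes (fzero ∷ w)  | .[] , j , w≡ , inj₁ refl = [] , suc j , cong (fzero ∷_) w≡ , inj₁ refl
splitTrailingOnes (fsuc y ∷ w) | .[] , j , w≡ , inj₁ refl =
  [ fsuc y ] , j , cong (fsuc y ∷_) w≡ , inj₂ ([] , fsuc y , refl , λ ())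
splitTrailingOnes (x ∷ w) | .(v ++ [ y ]) , j , w≡ , inj₂ (v , y , refl , y≢1) =
  x ∷ v ++ [ y ] , j , cong (x ∷_) w≡ , inj₂ (x ∷ v , y , refl , y≢1)

module Pattern {m : ℕ} (k : Fin (suc m) → ℕ) where

  Code : Set
  Code = List (Fin (suc m)) × Vec ℕ m

  codeSize : Code → ℕ
  codeSize (w , b) = length w ℕ.+ ∣ b ∣

  codes : ℕ → List Code
  codes = cauchyProductWith _,_ words (compositions m)

  codes-enumerate : Enumerates codeSize codes
  codes-enumerate = record
    { unique   = cauchyProductWith-unique _,_ ,-injective words-enumerate (compositions-enumerate m)
    ; sound    = cauchyProductWith-sound _,_ ,-injective words-enumerate (compositions-enumerate m)
    ; complete = cauchyProductWith-complete _,_ ,-injective words-enumerate (compositions-enumerate m)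
    }
    where
      ,-injective : ∀ {w w′ : List (Fin (suc m))} {b b′ : Vec ℕ m} → (w , b) ≡ (w′ , b′) → w ≡ w′ × b ≡ b′
      ,-injective refl = refl , refl

  exponents : ℕ → Vec ℕ m → Fin (suc m) → ℕ
  exponents j b i = lookup (j ∷ b) i ℕ.+ k i

  encode : Code → List (Fin (suc m))
  encode (w , b) = w ++ blocks (exponents 0 b)

  K : ℕ
  K = sumℕFin (suc m) k

  blocks-exponents : ∀ j b → blocks (exponents j b) ≡ replicate j fzero ++ blocks (exponents 0 b)
  blocks-exponents j b = begin
    blocks (exponents j b)                                ≡⟨ blocks-suc (exponents j b) ⟩
    replicate (j ℕ.+ k fzero) fzero ++ Y                  ≡⟨ cong (_++ Y) (replicate-+ j (k fzero) fzero) ⟩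
    (replicate j fzero ++ replicate (k fzero) fzero) ++ Y ≡⟨ List.++-assoc (replicate j fzero) _ Y ⟩
    replicate j fzero ++ (replicate (k fzero) fzero ++ Y) ≡⟨ cong (replicate j fzero ++_) (sym (blocks-suc (exponents 0 b))) ⟩
    replicate j fzero ++ blocks (exponents 0 b)           ∎
    where
      open ≡-Reasoning
      Y : List (Fin (suc m))
      Y = map fsuc (blocks (exponents 0 b ∘ fsuc))

  length-encode : ∀ d → length (encode d) ≡ codeSize d ℕ.+ K
  length-encode (w , b) = begin
    length (w ++ blocks (exponents 0 b))           ≡⟨ List.length-++ w ⟩
    length w ℕ.+ length (blocks (exponents 0 b))   ≡⟨ cong (length w ℕ.+_) (length-blocks (exponents 0 b)) ⟩
    length w ℕ.+ sumℕFin (suc m) (exponents 0 b)   ≡⟨ cong (length w ℕ.+_) (sumℕFin-+ (suc m) (lookup (0 ∷ b)) k) ⟩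
    length w ℕ.+ (∣ b ∣ ℕ.+ K)                     ≡⟨ sym (ℕ.+-assoc (length w) ∣ b ∣ K) ⟩
    codeSize (w , b) ℕ.+ K                         ∎
    where open ≡-Reasoning

  tailBlocks : Vec ℕ m → List (Fin m)
  tailBlocks b = blocks (exponents 0 b ∘ fsuc)

  tailBlocks-injective : ∀ {b b′} → tailBlocks b ≡ tailBlocks b′ → b ≡ b′
  tailBlocks-injective {b} {b′} eq = begin
    b                    ≡⟨ sym (Vec.tabulate∘lookup b) ⟩
    tabulate (lookup b)  ≡⟨ Vec.tabulate-cong (λ i → ℕ.+-cancelʳ-≡ _ _ _ (exponents≗ i)) ⟩
    tabulate (lookup b′) ≡⟨ Vec.tabulate∘lookup b′ ⟩
    b′                   ∎
    where
      open ≡-Reasoning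
      exponents≗ : exponents 0 b ∘ fsuc ≗ exponents 0 b′ ∘ fsuc
      exponents≗ = blocks-injective _ _ eq

  encode-lastOne : 1 ≤ k fzero → ∀ w b →
                   encode (w , b) ≡ (w ++ replicate (k fzero ∸ 1) fzero) ++ fzero ∷ map fsuc (tailBlocks b)
  encode-lastOne k₁≥1 w b = begin
    w ++ blocks (exponents 0 b)                  ≡⟨ cong (w ++_) (blocks-suc (exponents 0 b)) ⟩
    w ++ (replicate (k fzero) fzero ++ Y)        ≡⟨ cong (λ e → w ++ (replicate e fzero ++ Y)) (sym (ℕ.m∸n+n≡m k₁≥1)) ⟩
    w ++ (replicate (t ℕ.+ 1) fzero ++ Y)        ≡⟨ cong (λ z → w ++ (z ++ Y)) (replicate-+ t 1 fzero) ⟩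
    w ++ ((replicate t fzero ++ [ fzero ]) ++ Y) ≡⟨ cong (w ++_) (List.++-assoc (replicate t fzero) [ fzero ] Y) ⟩
    w ++ (replicate t fzero ++ fzero ∷ Y)        ≡⟨ sym (List.++-assoc w (replicate t fzero) (fzero ∷ Y)) ⟩
    (w ++ replicate t fzero) ++ fzero ∷ Y        ∎
    where
      open ≡-Reasoning
      t : ℕ
      t = k fzero ∸ 1
      Y : List (Fin (suc m))
      Y = map fsuc (tailBlocks b)

  encode-injective : 1 ≤ k fzero → ∀ {d d′} → encode d ≡ encode d′ → d ≡ d′
  encode-injective k₁≥1 {w , b} {w′ , b′} eq
    with w≡w′ , tail≡ ← lastZero-injective _ _ (trans (sym (encode-lastOne k₁≥1 w b)) (trans eq (encode-lastOne k₁≥1 w′ b′)))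
    = cong₂ _,_ (List.++-cancelʳ _ w w′ w≡w′) (tailBlocks-injective tail≡)

  encode-endsWith : ∀ d → EndsWith k (encode d)
  encode-endsWith (w , b) with splitTrailingOnes w
  ... | u , j , refl , u-ok = u , exponents j b , (λ i → ℕ.m≤n+m (k i) _) , ω≡ , u-ok
    where
      ω≡ : (u ++ replicate j fzero) ++ blocks (exponents 0 b) ≡ u ++ blocks (exponents j b)
      ω≡ = trans (List.++-assoc u _ _) (cong (u ++_) (sym (blocks-exponents j b)))

  endsWith⇒encoded : ∀ {ω} → EndsWith k ω → ∃ λ d → ω ≡ encode d
  endsWith⇒encoded (u , a , k≤a , refl , _) = (u ++ replicate j fzero , b) , ω≡
    where
      open ≡-Reasoning
      j : ℕ
      j = a fzero ∸ k fzero
      b : Vec ℕ m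
      b = tabulate (λ i → a (fsuc i) ∸ k (fsuc i))
      a≗ : a ≗ exponents j b
      a≗ fzero    = sym (ℕ.m∸n+n≡m (k≤a fzero))
      a≗ (fsuc i) = sym (trans (cong (ℕ._+ k (fsuc i)) (Vec.lookup∘tabulate _ i)) (ℕ.m∸n+n≡m (k≤a (fsuc i))))
      ω≡ : u ++ blocks a ≡ (u ++ replicate j fzero) ++ blocks (exponents 0 b)
      ω≡ = begin
        u ++ blocks a                                        ≡⟨ cong (u ++_) (trans (blocks-cong a≗) (blocks-exponents j b)) ⟩
        u ++ (replicate j fzero ++ blocks (exponents 0 b))   ≡⟨ sym (List.++-assoc u _ _) ⟩
        (u ++ replicate j fzero) ++ blocks (exponents 0 b)   ∎

  K≤length : ∀ {ω} → EndsWith k ω → K ≤ length ω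
  K≤length ends with d , refl ← endsWith⇒encoded ends = subst (K ≤_) (sym (length-encode d)) (ℕ.m≤n+m K (codeSize d))

  patternWords : ℕ → List (List (Fin (suc m)))
  patternWords s = map encode (codes s)

  ∈-patternWords⇔ : ∀ {n ω} → K ≤ n → ω ∈ patternWords (n ∸ K) ⇔ (length ω ≡ n × EndsWith k ω)
  ∈-patternWords⇔ {n} {ω} K≤n = mk⇔ to from
    where
      to : ω ∈ patternWords (n ∸ K) → length ω ≡ n × EndsWith k ω
      to ω∈ with d , d∈ , refl ← ∈-map⁻ encode ω∈ =
        trans (length-encode d) (trans (cong (ℕ._+ K) (sound codes-enumerate d∈)) (ℕ.m∸n+n≡m K≤n)) , encode-endsWith d
      from : length ω ≡ n × EndsWith k ω → ω ∈ patternWords (n ∸ K)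
      from (len , ends) with d , refl ← endsWith⇒encoded ends =
        ∈-map⁺ encode (complete codes-enumerate {x = d}
          (trans (sym (ℕ.m+n∸n≡m (codeSize d) K)) (cong (_∸ K) (trans (sym (length-encode d)) len))))

  patternWords-unique : 1 ≤ k fzero → ∀ s → Unique (patternWords s)
  patternWords-unique k₁≥1 s = Unique.map⁺ (encode-injective k₁≥1) (unique codes-enumerate s)

module Sums {c r : Level} (R : CommutativeRing c r) where

  open CommutativeRing R hiding (zero) renaming (refl to ≈-refl; sym to ≈-sym; trans to ≈-trans)
  open Series R
  open import Relation.Binary.Reasoning.Setoid setoid
  open CommutativeSemigroupProperties *-commutativeSemigroup using (interchange; x∙yz≈y∙xz; x∙yz≈z∙xy)

  ∑Map : (A → Carrier) → List A → Carrier
  ∑Map f xs = ∑List (map f xs)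

  ∑Map-cong : {f g : A → Carrier} (xs : List A) → (∀ x → f x ≈ g x) → ∑Map f xs ≈ ∑Map g xs
  ∑Map-cong []       f≈g = ≈-refl
  ∑Map-cong (x ∷ xs) f≈g = +-cong (f≈g x) (∑Map-cong xs f≈g)

  ∑Map-map : (f : B → Carrier) (g : A → B) (xs : List A) → ∑Map f (map g xs) ≡ ∑Map (f ∘ g) xs
  ∑Map-map f g xs = cong ∑List (sym (List.map-∘ xs))

  ∑Map-singleton : (f : A → Carrier) (x : A) → ∑Map f [ x ] ≈ f x
  ∑Map-singleton f x = +-identityʳ (f x)

  ∑Map-++ : (f : A → Carrier) (xs ys : List A) → ∑Map f (xs ++ ys) ≈ ∑Map f xs + ∑Map f ys
  ∑Map-++ f []       ys = ≈-sym (+-identityˡ _)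
  ∑Map-++ f (x ∷ xs) ys = ≈-trans (+-congˡ (∑Map-++ f xs ys)) (≈-sym (+-assoc _ _ _))

  ∑Map-concatMap : (f : B → Carrier) (g : A → List B) (xs : List A) →
                   ∑Map f (concatMap g xs) ≈ ∑Map (λ x → ∑Map f (g x)) xs
  ∑Map-concatMap f g []       = ≈-refl
  ∑Map-concatMap f g (x ∷ xs) = ≈-trans (∑Map-++ f (g x) (concatMap g xs)) (+-congˡ (∑Map-concatMap f g xs))

  ∑Map-*ˡ : (a : Carrier) (f : A → Carrier) (xs : List A) → ∑Map (λ x → a * f x) xs ≈ a * ∑Map f xs
  ∑Map-*ˡ a f []       = ≈-sym (zeroʳ a)
  ∑Map-*ˡ a f (x ∷ xs) = ≈-trans (+-congˡ (∑Map-*ˡ a f xs)) (≈-sym (distribˡ a _ _))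

  ∑Map-cartesianProductWith : (f : A → B → C) {h : C → Carrier} {g : A → Carrier} {g′ : B → Carrier} →
    (∀ x y → h (f x y) ≈ g x * g′ y) → (xs : List A) (ys : List B) →
    ∑Map h (cartesianProductWith f xs ys) ≈ ∑Map g xs * ∑Map g′ ys
  ∑Map-cartesianProductWith f {h} {g} {g′} h≈ []       ys = ≈-sym (zeroˡ _)
  ∑Map-cartesianProductWith f {h} {g} {g′} h≈ (x ∷ xs) ys = begin
    ∑Map h (map (f x) ys ++ cartesianProductWith f xs ys)     ≈⟨ ∑Map-++ h (map (f x) ys) _ ⟩
    ∑Map h (map (f x) ys) + ∑Map h (cartesianProductWith f xs ys)
      ≈⟨ +-cong (≈-trans (reflexive (∑Map-map h (f x) ys)) (∑Map-cong ys (h≈ x)))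
                (∑Map-cartesianProductWith f h≈ xs ys) ⟩
    ∑Map (λ y → g x * g′ y) ys + ∑Map g xs * ∑Map g′ ys      ≈⟨ +-congʳ (∑Map-*ˡ (g x) g′ ys) ⟩
    g x * ∑Map g′ ys + ∑Map g xs * ∑Map g′ ys                ≈⟨ ≈-sym (distribʳ _ _ _) ⟩
    ∑Map g (x ∷ xs) * ∑Map g′ ys                             ∎

  ∑Map-tabulate : {n : ℕ} (f : A → Carrier) (g : Fin n → A) → ∑Map f (Data.List.tabulate g) ≡ ∑Fin n (f ∘ g)
  ∑Map-tabulate {n = zero}  f g = refl
  ∑Map-tabulate {n = suc n} f g = cong (f (g fzero) +_) (∑Map-tabulate f (g ∘ fsuc))

  ∑Map-upTo : (f : ℕ → Carrier) (n : ℕ) → ∑Map f (upTo n) ≈ ∑< n f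
  ∑Map-upTo f zero    = ≈-refl
  ∑Map-upTo f (suc n) = begin
    ∑Map f (upTo (suc n))        ≡⟨ cong (∑Map f) (sym (List.upTo-∷ʳ n)) ⟩
    ∑Map f (upTo n ++ [ n ])     ≈⟨ ∑Map-++ f (upTo n) [ n ] ⟩
    ∑Map f (upTo n) + ∑Map f [ n ] ≈⟨ +-cong (∑Map-upTo f n) (∑Map-singleton f n) ⟩
    ∑< n f + f n                 ∎

  ∑Map-↭ : (f : A → Carrier) {xs ys : List A} → xs ↭ ys → ∑Map f xs ≈ ∑Map f ys
  ∑Map-↭ f xs↭ys = foldr-commMonoid setoid +-isCommutativeMonoid (↭⇒↭ₛ′ isEquivalence (Perm.map⁺ f xs↭ys))

  ∑Map-unique : (f : A → Carrier) {xs ys : List A} → Unique xs → Unique ys →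
                (∀ {x} → x ∈ xs ⇔ x ∈ ys) → ∑Map f xs ≈ ∑Map f ys
  ∑Map-unique f xs! ys! same = ∑Map-↭ f (∼bag⇒↭ (unique∧set⇒bag xs! ys! same))

  ∏Map : (A → Carrier) → List A → Carrier
  ∏Map q []       = 1#
  ∏Map q (x ∷ xs) = q x * ∏Map q xs

  ∏Map-++ : (q : A → Carrier) (xs ys : List A) → ∏Map q (xs ++ ys) ≈ ∏Map q xs * ∏Map q ys
  ∏Map-++ q []       ys = ≈-sym (*-identityˡ _)
  ∏Map-++ q (x ∷ xs) ys = ≈-trans (*-congˡ (∏Map-++ q xs ys)) (≈-sym (*-assoc _ _ _))

  ∏Map-replicate : (q : A → Carrier) (j : ℕ) (x : A) → ∏Map q (replicate j x) ≡ pow (q x) j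
  ∏Map-replicate q zero    x = refl
  ∏Map-replicate q (suc j) x = cong (q x *_) (∏Map-replicate q j x)

  ∏Map-map : (q : B → Carrier) (f : A → B) (xs : List A) → ∏Map q (map f xs) ≡ ∏Map (q ∘ f) xs
  ∏Map-map q f []       = refl
  ∏Map-map q f (x ∷ xs) = cong (q (f x) *_) (∏Map-map q f xs)

  ∏Pow : {n : ℕ} → (Fin n → Carrier) → (Fin n → ℕ) → Carrier
  ∏Pow {n} q a = ∏Fin n (λ i → pow (q i) (a i))

  ∏Pow-cong : {n : ℕ} (q : Fin n → Carrier) {a a′ : Fin n → ℕ} → a ≗ a′ → ∏Pow q a ≡ ∏Pow q a′
  ∏Pow-cong {zero}  q a≗a′ = refl
  ∏Pow-cong {suc n} q a≗a′ = cong₂ (λ e rest → pow (q fzero) e * rest) (a≗a′ fzero) (∏Pow-cong (q ∘ fsuc) (a≗a′ ∘ fsuc))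

  ∏Pow-zero : {n : ℕ} (q : Fin n → Carrier) → ∏Pow q (λ _ → 0) ≈ 1#
  ∏Pow-zero {zero}  q = ≈-refl
  ∏Pow-zero {suc n} q = ≈-trans (*-identityˡ _) (∏Pow-zero (q ∘ fsuc))

  pow-+ : (x : Carrier) (a b : ℕ) → pow x (a ℕ.+ b) ≈ pow x a * pow x b
  pow-+ x zero    b = ≈-sym (*-identityˡ _)
  pow-+ x (suc a) b = ≈-trans (*-congˡ (pow-+ x a b)) (≈-sym (*-assoc _ _ _))

  ∏Pow-+ : {n : ℕ} (q : Fin n → Carrier) (a b : Fin n → ℕ) → ∏Pow q (λ i → a i ℕ.+ b i) ≈ ∏Pow q a * ∏Pow q b
  ∏Pow-+ {zero}  q a b = ≈-sym (*-identityˡ 1#)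
  ∏Pow-+ {suc n} q a b = ≈-trans (*-cong (pow-+ (q fzero) (a fzero) (b fzero)) (∏Pow-+ (q ∘ fsuc) (a ∘ fsuc) (b ∘ fsuc)))
                                 (interchange _ _ _ _)

  ∏Pow-step : {n : ℕ} (q : Fin n → Carrier) (c c′ : Fin n → ℕ) (x : Fin n) →
              c x ≡ suc (c′ x) → (∀ i → i ≢ x → c i ≡ c′ i) → ∏Pow q c ≈ q x * ∏Pow q c′
  ∏Pow-step {suc n} q c c′ fzero cx≡ c≡ = begin
    pow (q fzero) (c fzero) * ∏Pow (q ∘ fsuc) (c ∘ fsuc)
      ≡⟨ cong₂ (λ e rest → pow (q fzero) e * rest) cx≡ (∏Pow-cong (q ∘ fsuc) (λ i → c≡ (fsuc i) λ ())) ⟩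
    (q fzero * pow (q fzero) (c′ fzero)) * ∏Pow (q ∘ fsuc) (c′ ∘ fsuc) ≈⟨ *-assoc _ _ _ ⟩
    q fzero * ∏Pow q c′                                                ∎
  ∏Pow-step {suc n} q c c′ (fsuc x) cx≡ c≡ = begin
    pow (q fzero) (c fzero) * ∏Pow (q ∘ fsuc) (c ∘ fsuc)
      ≈⟨ *-cong (reflexive (cong (pow (q fzero)) (c≡ fzero λ ())))
                (∏Pow-step (q ∘ fsuc) (c ∘ fsuc) (c′ ∘ fsuc) x cx≡ (λ i i≢x → c≡ (fsuc i) (i≢x ∘ Fin.suc-injective))) ⟩
    pow (q fzero) (c′ fzero) * (q (fsuc x) * ∏Pow (q ∘ fsuc) (c′ ∘ fsuc)) ≈⟨ x∙yz≈y∙xz _ _ _ ⟩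
    q (fsuc x) * ∏Pow q c′                                                ∎

  weight≈∏Map : {n : ℕ} (q : Fin n → Carrier) (ω : List (Fin n)) → weight q ω ≈ ∏Map q ω
  weight≈∏Map q []      = ∏Pow-zero q
  weight≈∏Map q (x ∷ ω) = ≈-trans (∏Pow-step q (λ i → count i (x ∷ ω)) (λ i → count i ω) x count-x count-i)
                                  (*-congˡ (weight≈∏Map q ω))
    where
      count-x : count x (x ∷ ω) ≡ suc (count x ω)
      count-x = cong length (List.filter-accept (Fin._≟ x) refl)
      count-i : ∀ i → i ≢ x → count i (x ∷ ω) ≡ count i ω
      count-i i i≢x = cong length (List.filter-reject (Fin._≟ i) (i≢x ∘ sym))

  ∏Map-blocks : {n : ℕ} (q : Fin n → Carrier) (a : Fin n → ℕ) → ∏Map q (blocks a) ≈ ∏Pow q a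
  ∏Map-blocks {zero}  q a = ≈-refl
  ∏Map-blocks {suc n} q a = begin
    ∏Map q (blocks a)                                                       ≡⟨ cong (∏Map q) (blocks-suc a) ⟩
    ∏Map q (replicate (a fzero) fzero ++ map fsuc (blocks (a ∘ fsuc)))     ≈⟨ ∏Map-++ q (replicate (a fzero) fzero) _ ⟩
    ∏Map q (replicate (a fzero) fzero) * ∏Map q (map fsuc (blocks (a ∘ fsuc)))
      ≡⟨ cong₂ _*_ (∏Map-replicate q (a fzero) fzero) (∏Map-map q fsuc (blocks (a ∘ fsuc))) ⟩
    pow (q fzero) (a fzero) * ∏Map (q ∘ fsuc) (blocks (a ∘ fsuc))          ≈⟨ *-congˡ (∏Map-blocks (q ∘ fsuc) (a ∘ fsuc)) ⟩
    ∏Pow q a                                                                ∎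

  ∑<-cong : (n : ℕ) {f g : ℕ → Carrier} → (∀ j → f j ≈ g j) → ∑< n f ≈ ∑< n g
  ∑<-cong zero    f≈g = ≈-refl
  ∑<-cong (suc n) f≈g = +-cong (∑<-cong n f≈g) (f≈g n)

  ∑<-suc : (n : ℕ) (f : ℕ → Carrier) → ∑< (suc n) f ≈ f 0 + ∑< n (f ∘ suc)
  ∑<-suc zero    f = ≈-trans (+-identityˡ _) (≈-sym (+-identityʳ _))
  ∑<-suc (suc n) f = ≈-trans (+-congʳ (∑<-suc n f)) (+-assoc _ _ _)

  ∑<-vanishing : (n : ℕ) (f : ℕ → Carrier) → (∀ j → j < n → f j ≈ 0#) → ∑< n f ≈ 0#
  ∑<-vanishing zero    f f≈0 = ≈-refl
  ∑<-vanishing (suc n) f f≈0 =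
    ≈-trans (+-cong (∑<-vanishing n f (λ j j<n → f≈0 j (ℕ.m<n⇒m<1+n j<n))) (f≈0 n ℕ.≤-refl)) (+-identityˡ 0#)

  ∑<-*ˡ : (n : ℕ) (a : Carrier) (f : ℕ → Carrier) → ∑< n (λ j → a * f j) ≈ a * ∑< n f
  ∑<-*ˡ zero    a f = ≈-sym (zeroʳ a)
  ∑<-*ˡ (suc n) a f = ≈-trans (+-congʳ (∑<-*ˡ n a f)) (≈-sym (distribˡ a _ _))

  ⊛-cong : {f f′ g g′ : Ser} → (∀ j → f j ≈ f′ j) → (∀ j → g j ≈ g′ j) → ∀ n → (f ⊛ g) n ≈ (f′ ⊛ g′) n
  ⊛-cong f≈f′ g≈g′ n = ∑<-cong (suc n) (λ j → *-cong (f≈f′ j) (g≈g′ (n ∸ j)))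

  ⊛-*ˡ : (a : Carrier) (f g : Ser) → ∀ n → ((λ j → a * f j) ⊛ g) n ≈ a * (f ⊛ g) n
  ⊛-*ˡ a f g n = ≈-trans (∑<-cong (suc n) (λ j → *-assoc a (f j) (g (n ∸ j)))) (∑<-*ˡ (suc n) a _)

  ⊛-vanishing : (K : ℕ) {f : Ser} (g : Ser) → (∀ j → j < K → f j ≈ 0#) → ∀ n → n < K → (f ⊛ g) n ≈ 0#
  ⊛-vanishing K g f≈0 n n<K =
    ∑<-vanishing (suc n) _ (λ j j≤n → ≈-trans (*-congʳ (f≈0 j (ℕ.<-≤-trans j≤n n<K))) (zeroˡ _))

  ⊛-shift : (K : ℕ) {f : Ser} (g : Ser) → (∀ j → j < K → f j ≈ 0#) → ∀ t → (f ⊛ g) (K ℕ.+ t) ≈ ((λ j → f (K ℕ.+ j)) ⊛ g) t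
  ⊛-shift zero    g f≈0 t = ≈-refl
  ⊛-shift (suc K) {f} g f≈0 t = begin
    (f ⊛ g) (suc (K ℕ.+ t))                          ≈⟨ ∑<-suc (suc (K ℕ.+ t)) _ ⟩
    f 0 * g (suc (K ℕ.+ t)) + ((f ∘ suc) ⊛ g) (K ℕ.+ t) ≈⟨ +-congʳ (≈-trans (*-congʳ (f≈0 0 (s≤s ℕ.z≤n))) (zeroˡ _)) ⟩
    0# + ((f ∘ suc) ⊛ g) (K ℕ.+ t)                    ≈⟨ +-identityˡ _ ⟩
    ((f ∘ suc) ⊛ g) (K ℕ.+ t)                         ≈⟨ ⊛-shift K g (λ j j<K → f≈0 (suc j) (s≤s j<K)) t ⟩
    ((λ j → f (suc K ℕ.+ j)) ⊛ g) t                   ∎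

  monomial-vanishing : (a : Carrier) (K j : ℕ) → j < K → monomial a K j ≈ 0#
  monomial-vanishing a (suc K) zero    _         = ≈-refl
  monomial-vanishing a (suc K) (suc j) (s≤s j<K) = monomial-vanishing a K j j<K

  monomial-shift : (a : Carrier) (K t : ℕ) → monomial a K (K ℕ.+ t) ≡ monomial a 0 t
  monomial-shift a zero    t = refl
  monomial-shift a (suc K) t = monomial-shift a K t

  monomial₀-⊛ : (a : Carrier) (g : Ser) (t : ℕ) → (monomial a 0 ⊛ g) t ≈ a * g t
  monomial₀-⊛ a g t = begin
    (monomial a 0 ⊛ g) t                                     ≈⟨ ∑<-suc t _ ⟩
    a * g t + ∑< t (λ j → monomial a 0 (suc j) * g (t ∸ suc j)) ≈⟨ +-congˡ (∑<-vanishing t _ (λ j _ → zeroˡ _)) ⟩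
    a * g t + 0#                                             ≈⟨ +-identityʳ _ ⟩
    a * g t                                                  ∎

  module _ (ℓ : ℕ) (k : Fin ℓ → ℕ) (p : Fin ℓ → Carrier) where

    private
      K : ℕ
      K = sumℕFin ℓ k
      G : Ser
      G = geom (∑Fin ℓ p)
      P₂ : Ser
      P₂ = ∏Ser-from2 ℓ (λ i → geom (p i))
      X : Ser
      X = monomial (∏Pow p k) K ⊛ G

      X-vanishing : ∀ j → j < K → X j ≈ 0#
      X-vanishing = ⊛-vanishing K G (monomial-vanishing (∏Pow p k) K)

      X-shift : ∀ t → X (K ℕ.+ t) ≈ ∏Pow p k * G t
      X-shift t = begin
        X (K ℕ.+ t)                                    ≈⟨ ⊛-shift K G (monomial-vanishing (∏Pow p k) K) t ⟩
        ((λ j → monomial (∏Pow p k) K (K ℕ.+ j)) ⊛ G) t ≈⟨ ⊛-cong {g = G} (reflexive ∘ monomial-shift (∏Pow p k) K) (λ _ → ≈-refl) t ⟩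
        (monomial (∏Pow p k) 0 ⊛ G) t                  ≈⟨ monomial₀-⊛ (∏Pow p k) G t ⟩
        ∏Pow p k * G t                                 ∎

    rhs-below : ∀ n → n < K → rhs ℓ k p n ≈ 0#
    rhs-below = ⊛-vanishing K P₂ X-vanishing

    rhs-above : ∀ {n} → K ≤ n → rhs ℓ k p n ≈ ∏Pow p k * (G ⊛ P₂) (n ∸ K)
    rhs-above {n} K≤n = begin
      rhs ℓ k p n                           ≡⟨ cong (rhs ℓ k p) (sym (ℕ.m+[n∸m]≡n K≤n)) ⟩
      rhs ℓ k p (K ℕ.+ (n ∸ K))             ≈⟨ ⊛-shift K P₂ X-vanishing (n ∸ K) ⟩
      ((λ j → X (K ℕ.+ j)) ⊛ P₂) (n ∸ K)    ≈⟨ ⊛-cong {g = P₂} X-shift (λ _ → ≈-refl) (n ∸ K) ⟩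
      ((λ j → ∏Pow p k * G j) ⊛ P₂) (n ∸ K) ≈⟨ ⊛-*ˡ (∏Pow p k) G P₂ (n ∸ K) ⟩
      ∏Pow p k * (G ⊛ P₂) (n ∸ K)           ∎

  ∑Map-cauchyProductWith : (f : A → B → C) {E : ℕ → List A} {F : ℕ → List B}
    {h : C → Carrier} {g : A → Carrier} {g′ : B → Carrier} → (∀ x y → h (f x y) ≈ g x * g′ y) →
    ∀ s → ∑Map h (cauchyProductWith f E F s) ≈ ((λ t → ∑Map g (E t)) ⊛ (λ u → ∑Map g′ (F u))) s
  ∑Map-cauchyProductWith f {E} {F} {h} {g} {g′} h≈ s = begin
    ∑Map h (cauchyProductWith f E F s)
      ≈⟨ ∑Map-concatMap h (λ t → cartesianProductWith f (E t) (F (s ∸ t))) (upTo (suc s)) ⟩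
    ∑Map (λ t → ∑Map h (cartesianProductWith f (E t) (F (s ∸ t)))) (upTo (suc s))
      ≈⟨ ∑Map-cong (upTo (suc s)) (λ t → ∑Map-cartesianProductWith f h≈ (E t) (F (s ∸ t))) ⟩
    ∑Map (λ t → ∑Map g (E t) * ∑Map g′ (F (s ∸ t))) (upTo (suc s))
      ≈⟨ ∑Map-upTo _ (suc s) ⟩
    ((λ t → ∑Map g (E t)) ⊛ (λ u → ∑Map g′ (F u))) s
      ∎

  ∑Map-words : {L : ℕ} (q : Fin L → Carrier) (t : ℕ) → ∑Map (∏Map q) (words t) ≈ pow (∑Fin L q) t
  ∑Map-words q zero        = +-identityʳ 1#
  ∑Map-words {L} q (suc t) = ≈-trans (∑Map-cartesianProductWith _∷_ (λ _ _ → ≈-refl) (allFin L) (words t))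
                                     (*-cong (reflexive (∑Map-tabulate q (λ i → i))) (∑Map-words q t))

  ∑Map-compositions : (r : ℕ) (q : Fin r → Carrier) (s : ℕ) →
                      ∑Map (∏Pow q ∘ lookup) (compositions r s) ≈ ∏Ser r (λ i → geom (q i)) s
  ∑Map-compositions zero    q zero    = +-identityʳ 1#
  ∑Map-compositions zero    q (suc s) = ≈-refl
  ∑Map-compositions (suc r) q s       =
    ≈-trans (∑Map-cauchyProductWith _∷_ {E = [_]} {F = compositions r} {h = ∏Pow q ∘ lookup} {g = pow (q fzero)} (λ _ _ → ≈-refl) s)
            (⊛-cong (∑Map-singleton (pow (q fzero))) (∑Map-compositions r (q ∘ fsuc)) s)

  module _ {m : ℕ} (k : Fin (suc m) → ℕ) (p : Fin (suc m) → Carrier) where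

    open Pattern k

    weight-encode : ∀ w b → weight p (encode (w , b)) ≈ ∏Pow p k * (∏Map p w * ∏Pow (p ∘ fsuc) (lookup b))
    weight-encode w b = begin
      weight p (encode (w , b))                             ≈⟨ weight≈∏Map p (encode (w , b)) ⟩
      ∏Map p (w ++ blocks (exponents 0 b))                  ≈⟨ ∏Map-++ p w _ ⟩
      ∏Map p w * ∏Map p (blocks (exponents 0 b))            ≈⟨ *-congˡ (∏Map-blocks p (exponents 0 b)) ⟩
      ∏Map p w * ∏Pow p (exponents 0 b)                     ≈⟨ *-congˡ (∏Pow-+ p (lookup (0 ∷ b)) k) ⟩
      ∏Map p w * (∏Pow p (lookup (0 ∷ b)) * ∏Pow p k)       ≈⟨ *-congˡ (*-congʳ (*-identityˡ _)) ⟩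
      ∏Map p w * (∏Pow (p ∘ fsuc) (lookup b) * ∏Pow p k)    ≈⟨ x∙yz≈z∙xy _ _ _ ⟩
      ∏Pow p k * (∏Map p w * ∏Pow (p ∘ fsuc) (lookup b))    ∎

    ∑weight-patternWords : ∀ s → ∑Map (weight p) (patternWords s)
      ≈ ∏Pow p k * (geom (∑Fin (suc m) p) ⊛ ∏Ser m (λ i → geom (p (fsuc i)))) s
    ∑weight-patternWords s = begin
      ∑Map (weight p) (map encode (codes s))          ≡⟨ ∑Map-map (weight p) encode (codes s) ⟩
      ∑Map (weight p ∘ encode) (codes s)              ≈⟨ ∑Map-cong (codes s) (λ d → weight-encode (proj₁ d) (proj₂ d)) ⟩
      ∑Map (λ d → ∏Pow p k * codeWeight d) (codes s)  ≈⟨ ∑Map-*ˡ (∏Pow p k) codeWeight (codes s) ⟩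
      ∏Pow p k * ∑Map codeWeight (codes s)
        ≈⟨ *-congˡ (≈-trans (∑Map-cauchyProductWith _,_ {E = words} {F = compositions m} {h = codeWeight} (λ _ _ → ≈-refl) s)
                            (⊛-cong (∑Map-words p) (∑Map-compositions m (p ∘ fsuc)) s)) ⟩
      ∏Pow p k * (geom (∑Fin (suc m) p) ⊛ ∏Ser m (λ i → geom (p (fsuc i)))) s ∎
      where
        codeWeight : Code → Carrier
        codeWeight (w , b) = ∏Map p w * ∏Pow (p ∘ fsuc) (lookup b)

lemma2 : {c r : Level} (R : CommutativeRing c r) (ℓ : ℕ) → 2 ≤ ℓ →
    (k : Fin ℓ → ℕ) → ((i : Fin ℓ) → 1 ≤ k i) →
    (p : Fin ℓ → CommutativeRing.Carrier R) →
    (n : ℕ) (W : List (List (Fin ℓ))) → Unique W →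
    ((ω : List (Fin ℓ)) → (ω ∈ W) ⇔ ((length ω ≡ n) × EndsWith k ω)) →
    CommutativeRing._≈_ R
      (Series.∑List R (map (Series.weight R p) W))
      (Series.rhs R ℓ k p n)
lemma2 R (suc m) _ k k≥1 p n W W-unique W-spec = case n <? K of λ where
    (yes n<K) → begin
      ∑Map (weight p) W    ≈⟨ ∑Map-unique (weight p) W-unique AllPairs.[] (mk⇔ (⊥-elim ∘ tooShort n<K) λ ()) ⟩
      0#                   ≈⟨ ≈-sym (rhs-below (suc m) k p n n<K) ⟩
      rhs (suc m) k p n    ∎
    (no n≮K) → let K≤n = ℕ.≮⇒≥ n≮K in begin
      ∑Map (weight p) W
        ≈⟨ ∑Map-unique (weight p) W-unique (patternWords-unique (k≥1 fzero) (n ∸ K))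
                       (λ {ω} → ⇔-sym (∈-patternWords⇔ K≤n) ⇔-∘ W-spec ω) ⟩
      ∑Map (weight p) (patternWords (n ∸ K))
        ≈⟨ ∑weight-patternWords k p (n ∸ K) ⟩
      ∏Pow p k * (geom (∑Fin (suc m) p) ⊛ ∏Ser m (λ i → geom (p (fsuc i)))) (n ∸ K)
        ≈⟨ ≈-sym (rhs-above (suc m) k p K≤n) ⟩
      rhs (suc m) k p n    ∎
  where
    open CommutativeRing R using (_≈_; _*_; 0#; setoid) renaming (sym to ≈-sym)
    open Series R
    open Sums R
    open Pattern k
    open import Relation.Binary.Reasoning.Setoid setoid

    tooShort : n < K → ∀ {ω} → ω ∈ W → ⊥
    tooShort n<K {ω} ω∈W with len , ends ← Equivalence.to (W-spec ω) ω∈W =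
      ℕ.<⇒≱ n<K (subst (K ≤_) len (K≤length ends))
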